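{- Let $P=A\cup B$ be a bipartite poset and let $m=\min\{|A|,|B|\}$. If $m\ge 2$, then $\operatorname{Idim}(P)<m$ unless $P$ contains the standard example $S_m$.
   Context: A bipartite poset is a finite poset $P$ with a partition $P=A\cup B$ where $A\subseteq\operatorname{Min}(P)$ and $B\subseteq\operatorname{Max}(P)$. The interval dimension $\operatorname{Idim}(P)$ is the least positive integer $d$ such that there are interval orders $P_1,\dots,P_d$ on the ground set of $P$ with $x<y$ in $P$ iff $x<y$ in every $P_i$; for a bipartite poset this equals the least positive $d$ such that there are $d$ linear extensions of $P$ so that every incomparable pair $(a,b)\in A\times B$ has $a>b$ in at least one of them. The standard example $S_m$ ($m\ge2$) has minimal elements $a_1,\dots,a_m$ and maximal elements $b_1,\dots,b_m$ with $a_i<b_j$ iff $i\ne j$; "contains" means has a subposet isomorphic to it. -}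

module Defs where

open import Data.Nat using (ℕ; _≤_; _<_; _⊓_)
open import Data.Fin using (Fin)
open import Data.Fin.Properties using (_≟_)
open import Data.Bool using (Bool; T; not)
open import Data.Sum using (_⊎_; inj₁; inj₂)
open import Data.Product using (Σ; _×_)
open import Data.Empty using (⊥)
open import Relation.Nullary using (¬_)
open import Relation.Nullary.Decidable using (⌊_⌋)
open import Relation.Binary.PropositionalEquality using (_≡_)
open import Function.Definitions using (Injective)

-- A (finite) bipartite poset P = A ∪ B with A = Fin p ⊆ Min(P), B = Fin q ⊆ Max(P).
-- Since A consists of minimal and B of maximal elements, the only strict
-- comparabilities are a < b with a ∈ A, b ∈ B; these are given by `lt`.
record BipPoset : Set where
  field
    p  : ℕ
    q  : ℕ
    lt : Fin p → Fin q → Bool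

open BipPoset public

Elem : BipPoset → Set
Elem P = Fin (p P) ⊎ Fin (q P)

Lt : (P : BipPoset) → Elem P → Elem P → Set
Lt P (inj₁ a) (inj₂ b) = T (lt P a b)
Lt P _        _        = ⊥

mOf : BipPoset → ℕ
mOf P = p P ⊓ q P

S : ℕ → BipPoset
S m = record { p = m ; q = m ; lt = λ i j → not ⌊ i ≟ j ⌋ }

Contains : BipPoset → BipPoset → Set
Contains P Q =
  Σ (Elem Q → Elem P) λ h →
    Injective _≡_ _≡_ h ×
    (∀ x y → (Lt Q x y → Lt P (h x) (h y)) ×
             (Lt P (h x) (h y) → Lt Q x y))

-- A linear extension of P, represented by an injective ranking of the ground
-- set into ℕ (x before y iff rank x < rank y) extending the order of P.
record LinExt (P : BipPoset) : Set where
  field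
    rank     : Elem P → ℕ
    rank-inj : Injective _≡_ _≡_ rank
    extends  : ∀ x y → Lt P x y → rank x < rank y

open LinExt public

IntervalRealizer : (P : BipPoset) (d : ℕ) → Set
IntervalRealizer P d =
  Σ (Fin d → LinExt P) λ L →
    ∀ (a : Fin (p P)) (b : Fin (q P)) → ¬ T (lt P a b) →
      Σ (Fin d) λ i → rank (L i) (inj₂ b) < rank (L i) (inj₁ a)

IsIdim : BipPoset → ℕ → Set
IsIdim P d =
  1 ≤ d × IntervalRealizer P d ×
  (∀ d′ → 1 ≤ d′ → IntervalRealizer P d′ → d ≤ d′)

-- Call b ∈ B a partner of a ∈ A if b is above every element of A except a. Assume |A| ≤ |B|.
-- If every a has a partner, the pairs (a, partner of a) form a copy of S_|A|. Otherwise some c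
-- has no partner, and the |A| − 1 linear extensions that put some j ≠ c on top with c right
-- below it reverse every incomparable pair (a, b): for a ≠ c take j = a; for a = c, b is not a
-- partner of c, so some j ≠ c is incomparable to b, and the extension for that j does it.
-- The case |B| ≤ |A| is the same argument in the dual poset: S_m is self-dual, and reversing
-- linear extensions turns a realizer of the dual into one of P.
module Submission where

open import Defs
open import Data.Nat as ℕ using (ℕ; _≤_; _<_; _∸_; pred; z<s; s<s; >-nonZero)
open import Data.Nat.Properties
  using (≤-total; <⇒≤; m≤n⇒m⊓n≡m; m≥n⇒m⊓n≡n; ∸-monoʳ-<; ∸-cancelˡ-≡; pred-mono-≤; m≤pred[n]⇒suc[m]≤n)
open import Data.Fin as Fin using (Fin; toℕ; join; splitAt; combine; punchIn; punchOut; #_)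
open import Data.Fin.Properties
  using (_≟_; toℕ-injective; splitAt-join; combine-monoˡ-<; combine-injectiveʳ; punchIn-punchOut; all?; any?; ¬∀⟶∃¬)
open import Data.Bool using (true; false; T)
open import Data.Sum as Sum using (_⊎_; inj₁; inj₂; swap)
open import Data.Sum.Properties using (swap-involutive; inj₁-injective; inj₂-injective)
open import Data.Product using (Σ; ∃; _×_; _,_; proj₁; proj₂)
open import Data.List using (map; allFin)
open import Data.List.Extrema.Nat using (max; xs≤max)
open import Data.List.Relation.Unary.All as All using ()
open import Data.List.Relation.Unary.All.Properties using (map⁻)
open import Data.List.Membership.Propositional.Properties using (∈-allFin)
open import Data.Unit using (tt)
open import Relation.Nullary using (¬_; Dec; yes; no; contradiction)
open import Relation.Nullary.Decidable using (¬?; _×-dec_; _→-dec_; T?)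
open import Relation.Binary.PropositionalEquality using (_≡_; _≢_; refl; sym; trans; cong; subst; module ≡-Reasoning)
open import Function.Definitions using (Injective)
open import Function using (_∘_; case_of_)

join-injective : ∀ m n {x y : Fin m ⊎ Fin n} → join m n x ≡ join m n y → x ≡ y
join-injective m n {x} {y} e = begin
  x                      ≡⟨ splitAt-join m n x ⟨
  splitAt m (join m n x) ≡⟨ cong (splitAt m) e ⟩
  splitAt m (join m n y) ≡⟨ splitAt-join m n y ⟩
  y                      ∎
  where open ≡-Reasoning

module _ (P : BipPoset) {k : ℕ} (level : Elem P → Fin k)
         (level-mono : ∀ x y → Lt P x y → level x Fin.< level y) where

  -- Ties between equal levels are broken by a fixed enumeration of the ground set.
  levelExt : LinExt P
  levelExt = record
    { rank     = λ x → toℕ (combine (level x) (join (p P) (q P) x))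
    ; rank-inj = λ {x} {y} e →
        join-injective (p P) (q P)
          (combine-injectiveʳ (level x) _ (level y) _ (toℕ-injective e))
    ; extends  = λ x y x<y → combine-monoˡ-< _ _ (level-mono x y x<y)
    }

  levelExt-< : ∀ x y → level x Fin.< level y → rank levelExt x < rank levelExt y
  levelExt-< x y = combine-monoˡ-< _ _

Reverses : {P : BipPoset} → LinExt P → Fin (p P) → Fin (q P) → Set
Reverses L a b = rank L (inj₂ b) < rank L (inj₁ a)

module Raise (P : BipPoset) (u v : Fin (p P)) where

  level : Elem P → Fin 6
  level (inj₁ a) with a ≟ u | a ≟ v
  ... | yes _ | _     = # 4
  ... | no _  | yes _ = # 2
  ... | no _  | no _  = # 0
  level (inj₂ b) with lt P u b | lt P v b
  ... | true  | _     = # 5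
  ... | false | true  = # 3
  ... | false | false = # 1

  level-mono : ∀ x y → Lt P x y → level x Fin.< level y
  level-mono (inj₁ a) (inj₂ b) a<b with a ≟ u | a ≟ v
  level-mono (inj₁ a) (inj₂ b) a<b | yes refl | _ with lt P a b
  ... | true = s<s (s<s (s<s (s<s z<s)))
  level-mono (inj₁ a) (inj₂ b) a<b | no _ | yes refl with lt P u b | lt P a b
  ... | true  | _    = s<s (s<s z<s)
  ... | false | true = s<s (s<s z<s)
  level-mono (inj₁ a) (inj₂ b) a<b | no _ | no _ with lt P u b | lt P v b
  ... | true  | _     = z<s
  ... | false | true  = z<s
  ... | false | false = z<s

  raise : LinExt P
  raise = levelExt P level level-mono

  level-reverses-u : ∀ {b} → ¬ T (lt P u b) → level (inj₂ b) Fin.< level (inj₁ u)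
  level-reverses-u {b} u∥b with u ≟ u | lt P u b | lt P v b
  ... | no u≢u | _     | _     = contradiction refl u≢u
  ... | yes _  | true  | _     = contradiction tt u∥b
  ... | yes _  | false | true  = s<s (s<s (s<s z<s))
  ... | yes _  | false | false = s<s z<s

  level-reverses-v : ∀ {b} → ¬ T (lt P u b) → ¬ T (lt P v b) → level (inj₂ b) Fin.< level (inj₁ v)
  level-reverses-v {b} u∥b v∥b with v ≟ u | v ≟ v | lt P u b | lt P v b
  ... | _     | _      | true  | _     = contradiction tt u∥b
  ... | _     | _      | false | true  = contradiction tt v∥b
  ... | yes _ | _      | false | false = s<s z<s
  ... | no _  | yes _  | false | false = s<s z<s
  ... | no _  | no v≢v | false | false = contradiction refl v≢v

  raise-reverses-u : ∀ {b} → ¬ T (lt P u b) → Reverses raise u b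
  raise-reverses-u u∥b = levelExt-< P level level-mono (inj₂ _) (inj₁ u) (level-reverses-u u∥b)

  raise-reverses-v : ∀ {b} → ¬ T (lt P u b) → ¬ T (lt P v b) → Reverses raise v b
  raise-reverses-v u∥b v∥b =
    levelExt-< P level level-mono (inj₂ _) (inj₁ v) (level-reverses-v u∥b v∥b)

realizer-avoiding : ∀ {P m} (c : Fin m) (L : Fin m → LinExt P) →
  (∀ a b → ¬ T (lt P a b) → ∃ λ j → j ≢ c × Reverses (L j) a b) →
  IntervalRealizer P (pred m)
realizer-avoiding {P} {ℕ.suc n} c L cover = L ∘ punchIn c , reindex
  where
  reindex : ∀ a b → ¬ T (lt P a b) → Σ (Fin n) λ k → Reverses (L (punchIn c k)) a b
  reindex a b a∥b with j , j≢c , L-rev ← cover a b a∥b =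
    punchOut (j≢c ∘ sym) ,
    subst (λ i → Reverses (L i) a b) (sym (punchIn-punchOut (j≢c ∘ sym))) L-rev

Partner : (P : BipPoset) → Fin (p P) → Fin (q P) → Set
Partner P a b = ¬ T (lt P a b) × (∀ a′ → a′ ≢ a → T (lt P a′ b))

partner? : ∀ P a b → Dec (Partner P a b)
partner? P a b = ¬? (T? (lt P a b)) ×-dec all? λ a′ → ¬? (a′ ≟ a) →-dec T? (lt P a′ b)

no-partner⇒shared-incomparable : ∀ P c → ¬ ∃ (Partner P c) →
  ∀ b → ¬ T (lt P c b) → ∃ λ a → a ≢ c × ¬ T (lt P a b)
no-partner⇒shared-incomparable P c no-partner b c∥b
  with a , ¬[a≢c⇒a<b] ← ¬∀⟶∃¬ (p P) _ (λ a → ¬? (a ≟ c) →-dec T? (lt P a b))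
                                     (λ others<b → no-partner (b , c∥b , others<b))
  = a , (λ a≡c → ¬[a≢c⇒a<b] (λ a≢c → contradiction a≡c a≢c)) , (λ a<b → ¬[a≢c⇒a<b] (λ _ → a<b))

no-partner⇒realizer : ∀ P c → ¬ ∃ (Partner P c) → IntervalRealizer P (pred (p P))
no-partner⇒realizer P c no-partner = realizer-avoiding c (λ j → raise j c) cover
  where
  open Raise P
  cover : ∀ a b → ¬ T (lt P a b) → ∃ λ j → j ≢ c × Reverses (raise j c) a b
  cover a b a∥b = case a ≟ c of λ where
    (no a≢c) → a , a≢c , raise-reverses-u a c a∥b
    (yes refl) → let j , j≢c , j∥b = no-partner⇒shared-incomparable P c no-partner b a∥b
                 in j , j≢c , raise-reverses-v j c j∥b a∥b

record StandardCopy (P : BipPoset) (m : ℕ) : Set where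
  field
    low       : Fin m → Fin (p P)
    high      : Fin m → Fin (q P)
    low∥high  : ∀ i → ¬ T (lt P (low i) (high i))
    low<high  : ∀ {i j} → i ≢ j → T (lt P (low i) (high j))

module _ {P : BipPoset} {m : ℕ} (copy : StandardCopy P m) where
  open StandardCopy copy

  low-injective : Injective _≡_ _≡_ low
  low-injective {i} {j} e with i ≟ j
  ... | yes i≡j = i≡j
  ... | no i≢j  = contradiction (subst (λ a → T (lt P a (high j))) e (low<high i≢j)) (low∥high j)

  high-injective : Injective _≡_ _≡_ high
  high-injective {i} {j} e with i ≟ j
  ... | yes i≡j = i≡j
  ... | no i≢j  = contradiction (subst (λ b → T (lt P (low i) b)) (sym e) (low<high i≢j)) (low∥high i)

  standardCopy⇒contains : Contains P (S m)
  standardCopy⇒contains = h , h-injective , h-order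
    where
    h : Elem (S m) → Elem P
    h = Sum.map low high

    h-injective : Injective _≡_ _≡_ h
    h-injective {inj₁ i} {inj₁ j} e = cong inj₁ (low-injective (inj₁-injective e))
    h-injective {inj₂ i} {inj₂ j} e = cong inj₂ (high-injective (inj₂-injective e))

    h-order : ∀ x y → (Lt (S m) x y → Lt P (h x) (h y)) × (Lt P (h x) (h y) → Lt (S m) x y)
    h-order (inj₁ i) (inj₁ j) = (λ ()) , (λ ())
    h-order (inj₂ i) y        = (λ ()) , (λ ())
    h-order (inj₁ i) (inj₂ j) with i ≟ j
    ... | yes refl = (λ ()) , low∥high i
    ... | no i≢j   = (λ _ → low<high i≢j) , (λ _ → tt)

partners⇒standardCopy : ∀ {P} → (∀ a → ∃ (Partner P a)) → StandardCopy P (p P)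
partners⇒standardCopy partner = record
  { low      = λ a → a
  ; high     = λ a → proj₁ (partner a)
  ; low∥high = λ a → proj₁ (proj₂ (partner a))
  ; low<high = λ {i} {j} i≢j → proj₂ (proj₂ (partner j)) i i≢j
  }

CopyOrRealizer : BipPoset → ℕ → Set
CopyOrRealizer P m = StandardCopy P m ⊎ IntervalRealizer P (pred m)

standardCopy-or-realizer-over-A : ∀ P → CopyOrRealizer P (p P)
standardCopy-or-realizer-over-A P with all? (λ a → any? (partner? P a))
... | yes partner = inj₁ (partners⇒standardCopy partner)
... | no ¬partner with c , no-partner ← ¬∀⟶∃¬ (p P) _ (λ a → any? (partner? P a)) ¬partner
  = inj₂ (no-partner⇒realizer P c no-partner)

dual : BipPoset → BipPoset
dual P = record { p = q P ; q = p P ; lt = λ b a → lt P a b }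

Lt-dual : ∀ P x y → Lt P x y → Lt (dual P) (swap y) (swap x)
Lt-dual P (inj₁ a) (inj₂ b) a<b = a<b

standardCopy-dual : ∀ {P m} → StandardCopy (dual P) m → StandardCopy P m
standardCopy-dual copy = record
  { low      = high
  ; high     = low
  ; low∥high = low∥high
  ; low<high = λ i≢j → low<high (i≢j ∘ sym)
  }
  where open StandardCopy copy

swap-injective : ∀ {A B : Set} → Injective _≡_ _≡_ (swap {A = A} {B = B})
swap-injective {x = x} {y} e = trans (sym (swap-involutive x)) (trans (cong swap e) (swap-involutive y))

≤max-allFin : ∀ {n} (f : Fin n → ℕ) i → f i ≤ max 0 (map f (allFin n))
≤max-allFin f i = All.lookup (map⁻ (xs≤max 0 (map f (allFin _)))) (∈-allFin i)

module _ {P : BipPoset} (L : LinExt (dual P)) where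

  rank-bound : ℕ
  rank-bound = max 0 (map (rank L ∘ swap ∘ splitAt (p P)) (allFin (p P ℕ.+ q P)))

  rank≤rank-bound : ∀ x → rank L (swap x) ≤ rank-bound
  rank≤rank-bound x = subst (λ y → rank L (swap y) ≤ rank-bound) (splitAt-join (p P) (q P) x)
                     (≤max-allFin (rank L ∘ swap ∘ splitAt (p P)) (join (p P) (q P) x))

  reverseRank : Elem P → ℕ
  reverseRank x = rank-bound ∸ rank L (swap x)

  reverseRank-< : ∀ x y → rank L (swap y) < rank L (swap x) → reverseRank x < reverseRank y
  reverseRank-< x y y<x = ∸-monoʳ-< y<x (rank≤rank-bound x)

  reverseExt : LinExt P
  reverseExt = record
    { rank     = reverseRank
    ; rank-inj = λ {x} {y} e →
        swap-injective (rank-inj L (∸-cancelˡ-≡ (rank≤rank-bound x) (rank≤rank-bound y) e))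
    ; extends  = λ x y x<y → reverseRank-< x y (extends L (swap y) (swap x) (Lt-dual P x y x<y))
    }

realizer-dual : ∀ {P d} → IntervalRealizer (dual P) d → IntervalRealizer P d
realizer-dual (L , cover) = reverseExt ∘ L , λ a b a∥b →
  let i , L-rev = cover b a a∥b in i , reverseRank-< (L i) (inj₂ b) (inj₁ a) L-rev

standardCopy-or-realizer : ∀ P → CopyOrRealizer P (mOf P)
standardCopy-or-realizer P with ≤-total (p P) (q P)
... | inj₁ p≤q = subst (CopyOrRealizer P) (sym (m≤n⇒m⊓n≡m p≤q)) (standardCopy-or-realizer-over-A P)
... | inj₂ q≤p = subst (CopyOrRealizer P) (sym (m≥n⇒m⊓n≡n q≤p))
  (Sum.map standardCopy-dual realizer-dual (standardCopy-or-realizer-over-A (dual P)))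

lemma2p8 : (P : BipPoset) → 2 ≤ mOf P → ¬ Contains P (S (mOf P)) →
    (d : ℕ) → IsIdim P d → d < mOf P
lemma2p8 P 2≤m no-copy d (_ , _ , least) with standardCopy-or-realizer P
... | inj₁ copy = contradiction (standardCopy⇒contains copy) no-copy
... | inj₂ realizer = m≤pred[n]⇒suc[m]≤n {{>-nonZero (<⇒≤ 2≤m)}}
                         (least (pred (mOf P)) (pred-mono-≤ 2≤m) realizer)
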